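{- Fix an integer $n\geq 2$. Then $\varepsilon_2(n,l)=\mathcal{O}\!\left(n^{3l/4}\right)$ as $l\to\infty$.
   Context: A nonempty word $u$ is primitive if $u=v^m$ with $m$ a positive integer implies $m=1$; $|u|$ is its length. For an alphabet $\mathcal{A}$ of size $n$, $\varepsilon_2(n,l)$ is the number of pairs $(p,q)$ of primitive words over $\mathcal{A}$ with $|p|=2|q|=2l$, $pq$ not primitive, for which there exist nonempty words $\alpha,\beta$ and an integer $s\geq1$ with $\alpha\beta$ primitive, $q=(\alpha\beta)^{s}\alpha$, and either ($p=(\beta\alpha)^{2s}\beta$ and $|\beta|=2|\alpha|$) or ($p=(\beta\alpha)^{2s+1}\beta$ and $|\alpha|=2|\beta|$). -}

module Defs where

open import Data.Nat using (ℕ; _+_; _*_; _≤_; _^_)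
open import Data.Fin using (Fin)
open import Data.List using (List; []; _++_; concat; replicate; length)
open import Data.Product using (_×_; ∃-syntax)
import Data.Product
open import Data.Sum using (_⊎_)
open import Relation.Nullary using (¬_)
open import Relation.Binary.PropositionalEquality using (_≡_; _≢_)
open import Data.List.Relation.Unary.All using (All)
open import Data.List.Relation.Unary.Unique.Propositional using (Unique)

Word : ℕ → Set
Word n = List (Fin n)

pow : ∀ {n} → Word n → ℕ → Word n
pow v m = concat (replicate m v)

Primitive : ∀ {n} → Word n → Set
Primitive {n} u = (u ≢ []) × (∀ (v : Word n) (m : ℕ) → 1 ≤ m → u ≡ pow v m → m ≡ 1)

IsEps2Pair : (n l : ℕ) → Word n → Word n → Set
IsEps2Pair n l p q =
  Primitive p × Primitive q × length p ≡ 2 * l × length q ≡ l × ¬ Primitive (p ++ q) ×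
  (∃[ α ] ∃[ β ] ∃[ s ]
     (α ≢ []) × (β ≢ []) × 1 ≤ s × Primitive (α ++ β) × q ≡ pow (α ++ β) s ++ α ×
     ((p ≡ pow (β ++ α) (2 * s) ++ β × length β ≡ 2 * length α)
      ⊎ (p ≡ pow (β ++ α) (2 * s + 1) ++ β × length α ≡ 2 * length β)))

-- "ε₂(n , l)^4 ≤ B": every finite duplicate-free family of pairs (p , q) satisfying
-- IsEps2Pair n l has at most B^(1/4) elements, i.e. length^4 ≤ B.  Since the set of such
-- pairs is finite, this says exactly  (#{(p,q)})^4 ≤ B.
ε₂^4≤ : (n l B : ℕ) → Set
ε₂^4≤ n l B = ∀ (xs : List (Word n × Word n)) → Unique xs →
            All (λ pq → IsEps2Pair n l (Data.Product.proj₁ pq) (Data.Product.proj₂ pq)) xs →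
            length xs ^ 4 ≤ B

-- A counted pair (p , q) is determined by its case together with the root αβ: in the first
-- case α is the prefix of αβ of length |αβ|/3, in the second of length 2|αβ|/3, and then s is
-- fixed by |q| = s|αβ| + |α| = l.  The root has length 3a, where a is the shorter of |α| and
-- |β|, and s ≥ 1 gives 4a ≤ l.  So there are at most 2 Σ_{a ≤ ⌊l/4⌋} n^{3a} ≤ 4 n^{3⌊l/4⌋}
-- pairs, and the fourth power of this is at most 256 n^{3l}.
module Submission where

open import Defs
open import Data.Nat using (ℕ; _*_; _^_; _≤_)
open import Data.Product using (∃-syntax)

open import Data.Nat using (zero; suc; _+_; _/_; z≤n; s≤s; NonZero; >-nonZero)
open import Data.Nat.Properties
open import Data.Nat.DivMod using (m*n/n≡m; /-monoˡ-≤; m/n*n≤m)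
open import Data.Nat.Solver using (module +-*-Solver)
open import Data.Bool using (Bool; true; false)
open import Data.List using (List; []; _∷_; [_]; _++_; map; length; allFin; cartesianProduct; cartesianProductWith)
open import Data.List.Properties using (length-++; length-map; length-tabulate; length-++-sucʳ; ++-conicalˡ; ∷-injective)
open import Data.List.Membership.Propositional using (_∈_)
open import Data.List.Membership.Propositional.Properties
  using (∈-∃++; ∈-++⁻; ∈-++⁺ˡ; ∈-++⁺ʳ; ∈-allFin; ∈-cartesianProductWith⁺; ∈-cartesianProduct⁺)
open import Data.List.Relation.Binary.Subset.Propositional using (_⊆_)
open import Data.List.Relation.Unary.Any using (here; there)
open import Data.List.Relation.Unary.All as All using (All; []; _∷_)
open import Data.List.Relation.Unary.AllPairs using ([]; _∷_)
open import Data.List.Relation.Unary.Unique.Propositional using (Unique)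
open import Data.Product using (_×_; _,_; proj₁; proj₂)
open import Data.Sum using (inj₁; inj₂)
open import Function using (_∘_)
open import Relation.Nullary using (contradiction)
open import Relation.Binary.PropositionalEquality using (_≡_; _≢_; refl; sym; trans; cong; cong₂; subst)

private
  variable
    A K : Set
    xs ys : List A

∈-remove : ∀ {x k : A} (ys zs : List A) → x ∈ ys ++ k ∷ zs → x ≢ k → x ∈ ys ++ zs
∈-remove ys zs x∈ x≢k with ∈-++⁻ ys x∈
... | inj₁ x∈ys         = ∈-++⁺ˡ x∈ys
... | inj₂ (here x≡k)   = contradiction x≡k x≢k
... | inj₂ (there x∈zs) = ∈-++⁺ʳ ys x∈zs

unique∧⊆⇒length≤ : Unique xs → xs ⊆ ys → length xs ≤ length ys
unique∧⊆⇒length≤ [] _ = z≤n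
unique∧⊆⇒length≤ {xs = x ∷ xs} (x∉xs ∷ unique) x∷xs⊆ys with ∈-∃++ (x∷xs⊆ys (here refl))
... | ys , zs , refl = subst (suc (length xs) ≤_) (sym (length-++-sucʳ ys x zs))
  (s≤s (unique∧⊆⇒length≤ unique λ y∈xs →
    ∈-remove ys zs (x∷xs⊆ys (there y∈xs)) λ y≡x → All.lookup x∉xs y∈xs (sym y≡x)))

module _ {P : A → Set} (key : ∀ {x} → P x → K) where

  length-reduce : (ps : All P xs) → length (All.reduce key ps) ≡ length xs
  length-reduce []       = refl
  length-reduce (_ ∷ ps) = cong suc (length-reduce ps)

  reduce⊆ : (∀ {x} (px : P x) → key px ∈ ys) → (ps : All P xs) → All.reduce key ps ⊆ ys
  reduce⊆ key∈ys (px ∷ _)  (here refl) = key∈ys px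
  reduce⊆ key∈ys (_  ∷ ps) (there k∈)  = reduce⊆ key∈ys ps k∈

  module _ (key-injective : ∀ {x y} (px : P x) (py : P y) → key px ≡ key py → x ≡ y) where

    reduce-≢ : ∀ {x} (px : P x) → All (x ≢_) xs → (ps : All P xs) → All (key px ≢_) (All.reduce key ps)
    reduce-≢ px []             []        = []
    reduce-≢ px (x≢y ∷ x≢ys) (py ∷ ps) = (λ eq → x≢y (key-injective px py eq)) ∷ reduce-≢ px x≢ys ps

    unique-reduce : Unique xs → (ps : All P xs) → Unique (All.reduce key ps)
    unique-reduce []              []        = []
    unique-reduce (x∉xs ∷ unique) (px ∷ ps) = reduce-≢ px x∉xs ps ∷ unique-reduce unique ps

    length≤-of-injective-key : (∀ {x} (px : P x) → key px ∈ ys) → Unique xs → All P xs →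
                               length xs ≤ length ys
    length≤-of-injective-key key∈ys unique ps = subst (_≤ _) (length-reduce ps)
      (unique∧⊆⇒length≤ (unique-reduce unique ps) (reduce⊆ key∈ys ps))

length-cartesianProductWith : ∀ {B C : Set} (f : A → B → C) (xs : List A) (ys : List B) →
                              length (cartesianProductWith f xs ys) ≡ length xs * length ys
length-cartesianProductWith f []       ys = refl
length-cartesianProductWith f (x ∷ xs) ys = trans (length-++ (map (f x) ys))
  (cong₂ _+_ (length-map (f x) ys) (length-cartesianProductWith f xs ys))

words : (n k : ℕ) → List (Word n)
words n zero    = [ [] ]
words n (suc k) = cartesianProductWith _∷_ (allFin n) (words n k)

length-words : ∀ n k → length (words n k) ≡ n ^ k
length-words n zero    = refl
length-words n (suc k) = trans (length-cartesianProductWith _∷_ (allFin n) (words n k))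
  (cong₂ _*_ (length-tabulate {n = n} (λ i → i)) (length-words n k))

∈-words : ∀ {n} (w : Word n) → w ∈ words n (length w)
∈-words []      = here refl
∈-words (i ∷ w) = ∈-cartesianProductWith⁺ _∷_ (∈-allFin i) (∈-words w)

taggedWords : (n k : ℕ) → List (Bool × Word n)
taggedWords n k = cartesianProduct (true ∷ false ∷ []) (words n k)

length-taggedWords : ∀ n k → length (taggedWords n k) ≡ 2 * n ^ k
length-taggedWords n k = trans (length-cartesianProductWith _,_ (true ∷ false ∷ []) (words n k))
  (cong (2 *_) (length-words n k))

∈-taggedWords : ∀ {n k} b (w : Word n) → length w ≡ k → (b , w) ∈ taggedWords n k
∈-taggedWords b w refl = ∈-cartesianProduct⁺ (b∈ b) (∈-words w)
  where
  b∈ : ∀ b → b ∈ true ∷ false ∷ []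
  b∈ true  = here refl
  b∈ false = there (here refl)

roots : (n A : ℕ) → List (Bool × Word n)
roots n zero    = taggedWords n 0
roots n (suc A) = taggedWords n (3 * suc A) ++ roots n A

∈-roots : ∀ {n a} A b (w : Word n) → a ≤ A → length w ≡ 3 * a → (b , w) ∈ roots n A
∈-roots zero    b w z≤n |w| = ∈-taggedWords b w |w|
∈-roots (suc A) b w a≤1+A |w| with m≤n⇒m<n∨m≡n a≤1+A
... | inj₁ (s≤s a≤A) = ∈-++⁺ʳ (taggedWords _ (3 * suc A)) (∈-roots A b w a≤A |w|)
... | inj₂ refl      = ∈-++⁺ˡ (∈-taggedWords b w |w|)

2*n^m≤n^[3+m] : ∀ {n} m → 2 ≤ n → 2 * n ^ m ≤ n ^ (3 + m)
2*n^m≤n^[3+m] {n} m 2≤n = ≤-trans (*-monoˡ-≤ (n ^ m) 2≤n) (^-monoʳ-≤ n (m≤n+m (suc m) 2))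
  where instance _ = >-nonZero (≤-trans (s≤s z≤n) 2≤n)

length-roots≤ : ∀ {n} → 2 ≤ n → ∀ A → length (roots n A) ≤ 4 * n ^ (3 * A)
length-roots≤ {n} 2≤n zero    = ≤-trans (≤-reflexive (length-taggedWords n 0)) (m≤m+n 2 2)
length-roots≤ {n} 2≤n (suc A) = begin
  length (taggedWords n (3 * suc A) ++ roots n A)    ≡⟨ length-++ (taggedWords n (3 * suc A)) ⟩
  length (taggedWords n (3 * suc A)) + length (roots n A)
                                                     ≤⟨ +-mono-≤ (≤-reflexive (length-taggedWords n (3 * suc A)))
                                                                 (length-roots≤ 2≤n A) ⟩
  2 * N + 4 * n ^ (3 * A)                            ≡⟨ cong (2 * N +_) (*-assoc 2 2 (n ^ (3 * A))) ⟩
  2 * N + 2 * (2 * n ^ (3 * A))                      ≤⟨ +-monoʳ-≤ (2 * N) (*-monoʳ-≤ 2 2*n^[3A]≤N) ⟩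
  2 * N + 2 * N                                      ≡⟨ *-distribʳ-+ N 2 2 ⟨
  4 * N                                              ∎
  where
  open ≤-Reasoning
  N = n ^ (3 * suc A)
  2*n^[3A]≤N : 2 * n ^ (3 * A) ≤ N
  2*n^[3A]≤N = subst (λ e → 2 * n ^ (3 * A) ≤ n ^ e) (sym (*-suc 3 A)) (2*n^m≤n^[3+m] (3 * A) 2≤n)

length-pow : ∀ {n} (v : Word n) m → length (pow v m) ≡ m * length v
length-pow v zero    = refl
length-pow v (suc m) = trans (length-++ v) (cong (length v +_) (length-pow v m))

++-injective : ∀ (xs xs′ : List A) {ys ys′ : List A} → length xs ≡ length xs′ → xs ++ ys ≡ xs′ ++ ys′ →
               xs ≡ xs′ × ys ≡ ys′
++-injective []       []         _    eq = refl , eq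
++-injective (x ∷ xs) (x′ ∷ xs′) |xs| eq with ∷-injective eq
... | refl , eq′ with ++-injective xs xs′ (suc-injective |xs|) eq′
... | refl , refl = refl , refl

pow-exponent-injective : ∀ {n} (v u : Word n) (s s′ : ℕ) → v ≢ [] →
                         length (pow v s ++ u) ≡ length (pow v s′ ++ u) → s ≡ s′
pow-exponent-injective []      u _ _  v≢[] _ = contradiction refl v≢[]
pow-exponent-injective (x ∷ v) u s s′ _ eq = *-cancelʳ-≡ s s′ (length (x ∷ v))
  (+-cancelʳ-≡ _ _ _ (trans (sym (length-pow+ s)) (trans eq (length-pow+ s′))))
  where
  length-pow+ : ∀ t → length (pow (x ∷ v) t ++ u) ≡ t * length (x ∷ v) + length u
  length-pow+ t = trans (length-++ (pow (x ∷ v) t)) (cong (_+ length u) (length-pow (x ∷ v) t))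

pShape : ∀ {n} → Bool → Word n → Word n → ℕ → Word n
pShape true  α β s = pow (β ++ α) (2 * s) ++ β
pShape false α β s = pow (β ++ α) (2 * s + 1) ++ β

αWeight : Bool → ℕ
αWeight true  = 1
αWeight false = 2

-- a is |α| in the first case and |β| in the second.
record Witness {n} (l : ℕ) (p q : Word n) : Set where
  constructor witness
  field
    case      : Bool
    α β       : Word n
    s a       : ℕ
    α≢[]      : α ≢ []
    1≤s       : 1 ≤ s
    p≡        : p ≡ pShape case α β s
    q≡        : q ≡ pow (α ++ β) s ++ α
    length-q  : length q ≡ l
    length-αβ : length (α ++ β) ≡ 3 * a
    length-α  : length α ≡ αWeight case * a

  root : Bool × Word n
  root = case , α ++ β

open Witness using (root)

IsEps2Pair⇒Witness : ∀ {n l} {p q : Word n} → IsEps2Pair n l p q → Witness l p q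
IsEps2Pair⇒Witness (_ , _ , _ , |q| , _ , α , β , s , α≢[] , _ , 1≤s , _ , q≡ , inj₁ (p≡ , |β|)) =
  witness true α β s (length α) α≢[] 1≤s p≡ q≡ |q|
    (trans (length-++ α) (cong (length α +_) |β|)) (sym (*-identityˡ (length α)))
IsEps2Pair⇒Witness (_ , _ , _ , |q| , _ , α , β , s , α≢[] , _ , 1≤s , _ , q≡ , inj₂ (p≡ , |α|)) =
  witness false α β s (length β) α≢[] 1≤s p≡ q≡ |q|
    (trans (length-++ α) (trans (cong (_+ length β) |α|) (+-comm (2 * length β) (length β)))) |α|

root≡⇒length-α≡ : ∀ {n l} {p q p′ q′ : Word n} (w : Witness l p q) (w′ : Witness l p′ q′) →
                  root w ≡ root w′ → length (Witness.α w) ≡ length (Witness.α w′)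
root≡⇒length-α≡ (witness c α β _ a _ _ _ _ _ |αβ| |α|) (witness c′ α′ β′ _ a′ _ _ _ _ _ |αβ′| |α′|) eq
  with refl ← cong proj₁ eq
  = trans |α| (trans (cong (αWeight c *_) a≡a′) (sym |α′|))
  where
  a≡a′ : a ≡ a′
  a≡a′ = *-cancelˡ-≡ a a′ 3 (trans (sym |αβ|) (trans (cong (λ r → length (proj₂ r)) eq) |αβ′|))

root-injective : ∀ {n l} {p q p′ q′ : Word n} (w : Witness l p q) (w′ : Witness l p′ q′) →
                 root w ≡ root w′ → (p , q) ≡ (p′ , q′)
root-injective w@(witness _ α β s _ α≢[] _ refl refl |q| _ _)
               w′@(witness _ α′ β′ s′ _ _ _ refl refl |q′| _ _) eq
  with refl ← cong proj₁ eq
  with refl , refl ← ++-injective α α′ (root≡⇒length-α≡ w w′ eq) (cong proj₂ eq)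
  with refl ← pow-exponent-injective (α ++ β) α s s′ (α≢[] ∘ ++-conicalˡ α β) (trans |q| (sym |q′|))
  = refl

m≤αWeight*m : ∀ c m → m ≤ αWeight c * m
m≤αWeight*m true  m = m≤m+n m _
m≤αWeight*m false m = m≤m+n m _

4*a≤l : ∀ {n l} {p q : Word n} (w : Witness l p q) → 4 * Witness.a w ≤ l
4*a≤l {l = l} (witness c α β (suc k) a _ (s≤s z≤n) _ refl |q| |αβ| |α|) = begin
  4 * a                                  ≡⟨ +-comm a (3 * a) ⟩
  3 * a + a                              ≤⟨ +-mono-≤ (m≤m+n (3 * a) (k * (3 * a)))
                                                     (subst (a ≤_) (sym |α|) (m≤αWeight*m c a)) ⟩
  suc k * (3 * a) + length α             ≡⟨ cong (λ t → suc k * t + length α) |αβ| ⟨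
  suc k * length (α ++ β) + length α     ≡⟨ cong (_+ length α) (length-pow (α ++ β) (suc k)) ⟨
  length (pow (α ++ β) (suc k)) + length α ≡⟨ length-++ (pow (α ++ β) (suc k)) ⟨
  length (pow (α ++ β) (suc k) ++ α)     ≡⟨ |q| ⟩
  l                                      ∎
  where open ≤-Reasoning

m*n≤o⇒m≤o/n : ∀ m n o .{{_ : NonZero n}} → m * n ≤ o → m ≤ o / n
m*n≤o⇒m≤o/n m n o m*n≤o = subst (_≤ o / n) (m*n/n≡m m n) (/-monoˡ-≤ n m*n≤o)

root∈roots : ∀ {n l} {p q : Word n} (w : Witness l p q) → root w ∈ roots n (l / 4)
root∈roots {l = l} w@(witness c α β _ a _ _ _ _ _ |αβ| _) =
  ∈-roots (l / 4) c (α ++ β) (m*n≤o⇒m≤o/n a 4 l (subst (_≤ l) (*-comm 4 a) (4*a≤l w))) |αβ|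

length≤length-roots : ∀ {n l} (xs : List (Word n × Word n)) → Unique xs →
                      All (λ pq → IsEps2Pair n l (proj₁ pq) (proj₂ pq)) xs →
                      length xs ≤ length (roots n (l / 4))
length≤length-roots xs = length≤-of-injective-key (root ∘ IsEps2Pair⇒Witness)
  (λ px py → root-injective (IsEps2Pair⇒Witness px) (IsEps2Pair⇒Witness py))
  (root∈roots ∘ IsEps2Pair⇒Witness)

[4*n^[3*⌊l/4⌋]]^4≤256*n^[3*l] : ∀ {n} → 2 ≤ n → ∀ l → (4 * n ^ (3 * (l / 4))) ^ 4 ≤ 256 * n ^ (3 * l)
[4*n^[3*⌊l/4⌋]]^4≤256*n^[3*l] {n} 2≤n l = begin
  (4 * n ^ (3 * (l / 4))) ^ 4       ≡⟨ solve 1 (λ x → (con 4 :* x) :^ 4 := con 256 :* x :^ 4) refl (n ^ (3 * (l / 4))) ⟩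
  256 * (n ^ (3 * (l / 4))) ^ 4     ≡⟨ cong (256 *_) (^-*-assoc n (3 * (l / 4)) 4) ⟩
  256 * n ^ (3 * (l / 4) * 4)       ≤⟨ *-monoʳ-≤ 256 (^-monoʳ-≤ n exponent≤) ⟩
  256 * n ^ (3 * l)                 ∎
  where
  open ≤-Reasoning
  open +-*-Solver
  instance _ = >-nonZero (≤-trans (s≤s z≤n) 2≤n)
  exponent≤ : 3 * (l / 4) * 4 ≤ 3 * l
  exponent≤ = subst (_≤ 3 * l) (sym (*-assoc 3 (l / 4) 4)) (*-monoʳ-≤ 3 (m/n*n≤m l 4))

theorem4p3 : (n : ℕ) → 2 ≤ n →
    ∃[ C ] ∃[ L ] ((l : ℕ) → L ≤ l → ε₂^4≤ n l (C * n ^ (3 * l)))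
theorem4p3 n 2≤n = 256 , 0 , λ l _ xs unique pairs → begin
  length xs ^ 4                ≤⟨ ^-monoˡ-≤ 4 (≤-trans (length≤length-roots xs unique pairs)
                                                        (length-roots≤ 2≤n (l / 4))) ⟩
  (4 * n ^ (3 * (l / 4))) ^ 4  ≤⟨ [4*n^[3*⌊l/4⌋]]^4≤256*n^[3*l] 2≤n l ⟩
  256 * n ^ (3 * l)            ∎
  where open ≤-Reasoning
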